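{- Let $S$ be a string of length $n$ and $1\le\tau\le n$. Let $\mathrm{ID}$ be a function defined on positions $j\in[1..n-\tau+1]$ such that $\mathrm{ID}(j)$ depends only on $S[j..j+\tau-1]$ (i.e., $S[j..j+\tau-1]=S[k..k+\tau-1]$ implies $\mathrm{ID}(j)=\mathrm{ID}(k)$), and let $$P=\Big\{j\in[1..n-\tau]\ \Big|\ \exists \ell\in[j-\tau+1..j]:\ \mathrm{ID}(j)=\min_{k\in[\ell..\ell+\tau-1]}\mathrm{ID}(k)\Big\}.$$ Then $P$ is a $(2\tau,2\tau)$-partitioning set of $S$.
   Context: $[a..b]=\{a,\dots,b\}$, $S[x..y]=S[x]\cdots S[y]$. A prefix of length $y\ge1$ of a string $W$ is a period of $W$ if $W[t]=W[t+y]$ for all $1\le t\le |W|-y$; $\rho_W$ is the shortest period length, and $W$ is periodic if $\rho_W\le |W|/2$. For $1\le\tau'\le\delta\le n$, a set $P\subseteq[n]$ is a $(\tau',\delta)$-partitioning set of $S$ if: (1) for any $i,j\in[1+\delta..n-\delta]$ with $S[i-\delta..i+\delta]=S[j-\delta..j+\delta]$ we have $i\in P\Leftrightarrow j\in P$; and (2) for any two consecutive positions $p<p'$ of $P\cup\{1,n+1\}$, either $p'-p\le\tau'$, or $p'-p>\tau'$ and $u=S[p..p'-1]$ is periodic with $\rho_u\le\tau'$. -}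

module Defs where

open import Data.Nat using (ℕ; _+_; _*_; _∸_; _≤_; _<_)
open import Data.Product using (Σ; _×_)
open import Data.Sum using (_⊎_)
open import Relation.Nullary using (¬_)
open import Relation.Binary.PropositionalEquality using (_≡_)
open import Function.Bundles using (_⇔_)

-- A string S of length n over alphabet A is modelled as S : ℕ → A, read
-- 1-indexed: S[1], ..., S[n] are S 1, ..., S n.  All notions below only
-- ever inspect S at positions in [1..n] (given the ranges involved).

SubEq : {A : Set} → (ℕ → A) → ℕ → ℕ → ℕ → Set
SubEq S x y len = ∀ t → t < len → S (x + t) ≡ S (y + t)

IsPeriod : {A : Set} → (ℕ → A) → (p L y : ℕ) → Set
IsPeriod S p L y = 1 ≤ y × y ≤ L × (∀ t → t + y < L → S (p + t) ≡ S (p + t + y))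

IsShortestPeriod : {A : Set} → (ℕ → A) → (p L ρ : ℕ) → Set
IsShortestPeriod S p L ρ = IsPeriod S p L ρ × (∀ z → IsPeriod S p L z → ρ ≤ z)

PeriodicWithin : {A : Set} → (ℕ → A) → (p L τ' : ℕ) → Set
PeriodicWithin S p L τ' =
  Σ ℕ (λ ρ → IsShortestPeriod S p L ρ × 2 * ρ ≤ L × ρ ≤ τ')

WithEnds : ℕ → (ℕ → Set) → ℕ → Set
WithEnds n P x = P x ⊎ (x ≡ 1 ⊎ x ≡ n + 1)

IsPartitioningSet : {A : Set} → (ℕ → A) → (n τ' δ : ℕ) → (ℕ → Set) → Set
IsPartitioningSet S n τ' δ P =
  (∀ x → P x → 1 ≤ x × x ≤ n)
  × (∀ i j → 1 + δ ≤ i → i + δ ≤ n → 1 + δ ≤ j → j + δ ≤ n →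
       SubEq S (i ∸ δ) (j ∸ δ) (2 * δ + 1) → (P i ⇔ P j))
  × (∀ p p' → WithEnds n P p → WithEnds n P p' → p < p' →
       (∀ q → p < q → q < p' → ¬ WithEnds n P q) →
       (p' ∸ p ≤ τ') ⊎ (τ' < p' ∸ p × PeriodicWithin S p (p' ∸ p) τ'))

-- The window is parametrised by its right end r = ℓ+τ-1 ∈ [j..j+τ-1]
-- (so ℓ ≤ 0 is allowed); k ∈ [ℓ..r] is  r < k + τ  and  k ≤ r.
-- Since j itself lies in the window, "ID(j) = min" unfolds to
-- "ID(j) ≤ ID(k) for every k in the window".
InP : (n τ : ℕ) → (ℕ → ℕ) → ℕ → Set
InP n τ ID j =
  1 ≤ j × j ≤ n ∸ τ ×
  Σ ℕ (λ r → j ≤ r × r < j + τ ×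
    (∀ k → 1 ≤ k → k ≤ n ∸ τ + 1 → r < k + τ → k ≤ r → ID j ≤ ID k))

-- Every position j ∈ P is the minimum of ID over a window of width τ, and a
-- window reaches at most τ - 1 positions to either side of j, each of which
-- reads only τ letters; so membership of j in P is decided by S[j-2τ..j+2τ].
-- Conversely the minimum of ID over any full window [p+1..p+τ] lies in P, so
-- no two consecutive positions of P ∪ {1, n+1} are more than 2τ apart, and
-- the periodic alternative of condition (2) never arises.
module Submission where

open import Defs
open import Data.Nat using (ℕ; zero; suc; _+_; _*_; _∸_; _≤_; _<_; z≤n; s≤s; s≤s⁻¹; _≤?_)
open import Data.Nat.Properties
open import Data.Product using (∃; ∃-syntax; _×_; _,_; proj₁; proj₂)
open import Data.Sum using (_⊎_; inj₁; inj₂; [_,_])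
open import Data.Empty using (⊥-elim)
open import Relation.Nullary using (¬_; yes; no)
open import Relation.Binary.PropositionalEquality using (_≡_; refl; sym; trans; cong; subst; subst₂)
open import Function.Bundles using (mk⇔)

IsArgMinOn : (ℕ → ℕ) → ℕ → ℕ → ℕ → Set
IsArgMinOn f a b m = a ≤ m × m ≤ b × (∀ k → a ≤ k → k ≤ b → f m ≤ f k)

≤-suc⇒≤⊎≡ : ∀ {k c} → k ≤ suc c → k ≤ c ⊎ k ≡ suc c
≤-suc⇒≤⊎≡ k≤1+c with m≤n⇒m<n∨m≡n k≤1+c
... | inj₁ k<1+c = inj₁ (s≤s⁻¹ k<1+c)
... | inj₂ k≡1+c = inj₂ k≡1+c

argmin-+ : (f : ℕ → ℕ) (a L : ℕ) → ∃ (IsArgMinOn f a (L + a))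
argmin-+ f a zero = a , ≤-refl , ≤-refl , λ k a≤k k≤a → ≤-reflexive (cong f (≤-antisym a≤k k≤a))
argmin-+ f a (suc L) with argmin-+ f a L
... | m , a≤m , m≤L+a , min with ≤-total (f m) (f (suc L + a))
...   | inj₁ fm≤fc =
  m , a≤m , m≤n⇒m≤1+n m≤L+a , λ k a≤k k≤ → [ min k a≤k , old≤new ] (≤-suc⇒≤⊎≡ k≤)
  where
  old≤new : ∀ {k} → k ≡ suc L + a → f m ≤ f k
  old≤new refl = fm≤fc
...   | inj₂ fc≤fm =
  suc L + a , m≤n+m a (suc L) , ≤-refl , λ k a≤k k≤ → [ new≤old k a≤k , new≤new ] (≤-suc⇒≤⊎≡ k≤)
  where
  new≤old : ∀ k → a ≤ k → k ≤ L + a → f (suc L + a) ≤ f k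
  new≤old k a≤k k≤L+a = ≤-trans fc≤fm (min k a≤k k≤L+a)
  new≤new : ∀ {k} → k ≡ suc L + a → f (suc L + a) ≤ f k
  new≤new refl = ≤-refl

argmin : (f : ℕ → ℕ) {a b : ℕ} → a ≤ b → ∃ (IsArgMinOn f a b)
argmin f {a} a≤b = subst (λ b → ∃ (IsArgMinOn f a b)) (m∸n+n≡m a≤b) (argmin-+ f a (_ ∸ a))

module _ {A : Set} (S : ℕ → A) where

  SubEq-sym : ∀ {a b L} → SubEq S a b L → SubEq S b a L
  SubEq-sym sub t t<L = sym (sub t t<L)

  SubEq-≤ : ∀ {a b M L} → M ≤ L → SubEq S a b L → SubEq S a b M
  SubEq-≤ M≤L sub t t<M = sub t (<-≤-trans t<M M≤L)

  SubEq-factor : ∀ {a b y M L} → y + M ≤ L →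
    SubEq S a b L → SubEq S (a + y) (b + y) M
  SubEq-factor {a} {b} {y} y+M≤L sub t t<M =
    subst₂ _≡_ (cong S (sym (+-assoc a y t))) (cong S (sym (+-assoc b y t)))
      (sub (y + t) (<-≤-trans (+-monoʳ-< y t<M) y+M≤L))

∸-large : ∀ {p p' d} → p < p' → d < p' ∸ p → p + d < p'
∸-large {p} {p'} {d} p<p' d<p'∸p =
  subst (_≤ p') (cong suc (+-comm d p)) (m≤o∸n⇒m+n≤o (suc d) (<⇒≤ p<p') d<p'∸p)

WithEnds-≤ : ∀ {n} {P : ℕ → Set} → (∀ x → P x → x ≤ n) → ∀ x → WithEnds n P x → x ≤ n + 1
WithEnds-≤ {n} P≤n x (inj₁ Px)           = ≤-trans (P≤n x Px) (m≤m+n n 1)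
WithEnds-≤ {n} P≤n x (inj₂ (inj₁ refl)) = m≤n+m 1 n
WithEnds-≤     P≤n x (inj₂ (inj₂ refl)) = ≤-refl

module WindowMinima {A : Set} (S : ℕ → A) (n τ : ℕ) (ID : ℕ → ℕ) where

  FactorDetermined : Set
  FactorDetermined = ∀ j k → 1 ≤ j → j ≤ n ∸ τ + 1 → 1 ≤ k → k ≤ n ∸ τ + 1 →
    SubEq S j k τ → ID j ≡ ID k

  MinOnWindow : ℕ → ℕ → Set
  MinOnWindow j r = ∀ k → 1 ≤ k → k ≤ n ∸ τ + 1 → r < k + τ → k ≤ r → ID j ≤ ID k

  InP-bounded : ∀ j → InP n τ ID j → 1 ≤ j × j ≤ n
  InP-bounded j (1≤j , j≤n∸τ , _) = 1≤j , ≤-trans j≤n∸τ (m∸n≤m n τ)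

  offset-inDomain : ∀ {c L y} → 1 ≤ c → c + L ≤ n → y + τ ≤ L → 1 ≤ c + y × c + y ≤ n ∸ τ + 1
  offset-inDomain {c} {L} {y} 1≤c c+L≤n y+τ≤L =
    ≤-trans 1≤c (m≤m+n c y) ,
    ≤-trans (m+n≤o⇒m≤o∸n (c + y) c+y+τ≤n) (m≤m+n (n ∸ τ) 1)
    where
    c+y+τ≤n : c + y + τ ≤ n
    c+y+τ≤n = ≤-trans (≤-reflexive (+-assoc c y τ)) (≤-trans (+-monoʳ-≤ c y+τ≤L) c+L≤n)

  argmin-InP : 1 ≤ τ → ∀ p → p + (τ + τ) ≤ n → ∃[ m ] p < m × m ≤ p + τ × InP n τ ID m
  argmin-InP 1≤τ p p+2τ≤n with argmin ID (m<m+n p 1≤τ)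
  ... | m , p<m , m≤p+τ , min =
    m , p<m , m≤p+τ ,
    ≤-trans (s≤s z≤n) p<m ,
    m+n≤o⇒m≤o∸n m (≤-trans (+-monoˡ-≤ τ m≤p+τ) (≤-trans (≤-reflexive (+-assoc p τ τ)) p+2τ≤n)) ,
    p + τ , m≤p+τ , +-monoˡ-< τ p<m ,
    λ k _ _ p+τ<k+τ k≤p+τ → min k (+-cancelʳ-< τ p k p+τ<k+τ) k≤p+τ

  InP-between : 1 ≤ τ → ∀ p p' → p + (τ + τ) < p' → p' ≤ n + 1 →
    ∃[ m ] p < m × m < p' × InP n τ ID m
  InP-between 1≤τ p p' p+2τ<p' p'≤n+1 with argmin-InP 1≤τ p p+2τ≤n
    where
    p+2τ≤n : p + (τ + τ) ≤ n
    p+2τ≤n = s≤s⁻¹ (subst (p + (τ + τ) <_) (+-comm n 1) (<-≤-trans p+2τ<p' p'≤n+1))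
  ... | m , p<m , m≤p+τ , InP-m =
    m , p<m , ≤-<-trans (≤-trans m≤p+τ (+-monoʳ-≤ p (m≤m+n τ τ))) p+2τ<p' , InP-m

  InP-gap : 1 ≤ τ → ∀ p p' → WithEnds n (InP n τ ID) p' → p < p' →
    (∀ q → p < q → q < p' → ¬ WithEnds n (InP n τ ID) q) → p' ∸ p ≤ τ + τ
  InP-gap 1≤τ p p' Ends-p' p<p' gap with p' ∸ p ≤? τ + τ
  ... | yes small = small
  ... | no large
    with InP-between 1≤τ p p' (∸-large p<p' (≰⇒> large))
           (WithEnds-≤ (λ x InP-x → proj₂ (InP-bounded x InP-x)) p' Ends-p')
  ...   | m , p<m , m<p' , InP-m = ⊥-elim (gap m p<m m<p' (inj₁ InP-m))

  ID-agree : FactorDetermined → ∀ {a b L y} → 1 ≤ a → 1 ≤ b → a + L ≤ n → b + L ≤ n →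
    SubEq S a b L → y + τ ≤ L → ID (a + y) ≡ ID (b + y)
  ID-agree det 1≤a 1≤b a-fits b-fits sub y+τ≤L =
    let (1≤a+y , a+y≤) = offset-inDomain 1≤a a-fits y+τ≤L
        (1≤b+y , b+y≤) = offset-inDomain 1≤b b-fits y+τ≤L
    in det _ _ 1≤a+y a+y≤ 1≤b+y b+y≤ (SubEq-factor S y+τ≤L sub)

  MinOnWindow⇒offsets : ∀ {j a x} → (∀ y → y ≤ x → 1 ≤ a + y × a + y ≤ n ∸ τ + 1) →
    MinOnWindow j (a + x) → ∀ y → y ≤ x → x < y + τ → ID j ≤ ID (a + y)
  MinOnWindow⇒offsets {a = a} {x} dom min y y≤x x<y+τ =
    min (a + y) (proj₁ (dom y y≤x)) (proj₂ (dom y y≤x))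
      (subst (a + x <_) (sym (+-assoc a y τ)) (+-monoʳ-< a x<y+τ)) (+-monoʳ-≤ a y≤x)

  offsets⇒MinOnWindow : ∀ {j b x} → τ ≤ x →
    (∀ y → y ≤ x → x < y + τ → ID j ≤ ID (b + y)) → MinOnWindow j (b + x)
  offsets⇒MinOnWindow {j} {b} {x} τ≤x min k _ _ b+x<k+τ k≤b+x =
    subst (λ k → ID j ≤ ID k) b+y≡k (min y y≤x x<y+τ)
    where
    b≤k : b ≤ k
    b≤k = <⇒≤ (+-cancelʳ-< τ b k (≤-<-trans (+-monoʳ-≤ b τ≤x) b+x<k+τ))
    y : ℕ
    y = k ∸ b
    b+y≡k : b + y ≡ k
    b+y≡k = m+[n∸m]≡n b≤k
    y≤x : y ≤ x
    y≤x = +-cancelˡ-≤ b y x (subst (_≤ b + x) (sym b+y≡k) k≤b+x)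
    x<y+τ : x < y + τ
    x<y+τ = +-cancelˡ-< b x (y + τ)
      (subst (b + x <_) (trans (cong (_+ τ) (sym b+y≡k)) (+-assoc b y τ)) b+x<k+τ)

  -- Positions are offsets from the left ends a, b of the matching blocks, so that the
  -- windows, which may reach left of the centre a + δ, need no truncated subtraction.
  InP-shift : FactorDetermined → ∀ {δ} → τ + τ ≤ δ → ∀ {a b} → 1 ≤ a → 1 ≤ b →
    a + (δ + δ) ≤ n → b + (δ + δ) ≤ n → SubEq S a b (δ + δ) →
    InP n τ ID (a + δ) → InP n τ ID (b + δ)
  InP-shift det {δ} 2τ≤δ {a} {b} 1≤a 1≤b a-fits b-fits sub
            (_ , _ , r , a+δ≤r , r<a+δ+τ , min) =
    ≤-trans 1≤b (m≤m+n b δ) ,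
    m+n≤o⇒m≤o∸n (b + δ)
      (≤-trans (≤-reflexive (+-assoc b δ τ)) (≤-trans (+-monoʳ-≤ b δ+τ≤2δ) b-fits)) ,
    b + x , +-monoʳ-≤ b δ≤x , subst (b + x <_) (sym (+-assoc b δ τ)) (+-monoʳ-< b x<δ+τ) ,
    offsets⇒MinOnWindow τ≤x λ y y≤x x<y+τ →
      subst₂ _≤_ (agree δ+τ≤2δ) (agree (offset-fits y≤x))
        (MinOnWindow⇒offsets dom min′ y y≤x x<y+τ)
    where
    τ≤δ : τ ≤ δ
    τ≤δ = ≤-trans (m≤m+n τ τ) 2τ≤δ
    δ+τ≤2δ : δ + τ ≤ δ + δ
    δ+τ≤2δ = +-monoʳ-≤ δ τ≤δ
    a≤r : a ≤ r
    a≤r = ≤-trans (m≤m+n a δ) a+δ≤r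
    x : ℕ
    x = r ∸ a
    a+x≡r : a + x ≡ r
    a+x≡r = m+[n∸m]≡n a≤r
    δ≤x : δ ≤ x
    δ≤x = +-cancelˡ-≤ a δ x (subst (a + δ ≤_) (sym a+x≡r) a+δ≤r)
    x<δ+τ : x < δ + τ
    x<δ+τ = +-cancelˡ-< a x (δ + τ) (subst₂ _<_ (sym a+x≡r) (+-assoc a δ τ) r<a+δ+τ)
    τ≤x : τ ≤ x
    τ≤x = ≤-trans τ≤δ δ≤x
    offset-fits : ∀ {y} → y ≤ x → y + τ ≤ δ + δ
    offset-fits y≤x = <⇒≤ (<-≤-trans (+-monoˡ-< τ (≤-<-trans y≤x x<δ+τ))
      (≤-trans (≤-reflexive (+-assoc δ τ τ)) (+-monoʳ-≤ δ 2τ≤δ)))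
    agree : ∀ {y} → y + τ ≤ δ + δ → ID (a + y) ≡ ID (b + y)
    agree = ID-agree det 1≤a 1≤b a-fits b-fits sub
    dom : ∀ y → y ≤ x → 1 ≤ a + y × a + y ≤ n ∸ τ + 1
    dom y y≤x = offset-inDomain 1≤a a-fits (offset-fits y≤x)
    min′ : MinOnWindow (a + δ) (a + x)
    min′ = subst (MinOnWindow (a + δ)) (sym a+x≡r) min

  InP-local : FactorDetermined → ∀ {δ} → τ + τ ≤ δ → ∀ i j → 1 + δ ≤ i → i + δ ≤ n →
    1 + δ ≤ j → j + δ ≤ n → SubEq S (i ∸ δ) (j ∸ δ) (2 * δ + 1) →
    InP n τ ID i → InP n τ ID j
  InP-local det {δ} 2τ≤δ i j 1+δ≤i i+δ≤n 1+δ≤j j+δ≤n sub InP-i =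
    subst (InP n τ ID) (recentre 1+δ≤j)
      (InP-shift det 2τ≤δ (m+n≤o⇒m≤o∸n 1 1+δ≤i) (m+n≤o⇒m≤o∸n 1 1+δ≤j)
        (fits 1+δ≤i i+δ≤n) (fits 1+δ≤j j+δ≤n) (SubEq-≤ S 2δ≤2*δ+1 sub)
        (subst (InP n τ ID) (sym (recentre 1+δ≤i)) InP-i))
    where
    recentre : ∀ {i} → 1 + δ ≤ i → i ∸ δ + δ ≡ i
    recentre 1+δ≤i = m∸n+n≡m (m+n≤o⇒n≤o 1 1+δ≤i)
    fits : ∀ {i} → 1 + δ ≤ i → i + δ ≤ n → i ∸ δ + (δ + δ) ≤ n
    fits {i} 1+δ≤i i+δ≤n =
      subst (_≤ n) (trans (cong (_+ δ) (sym (recentre 1+δ≤i))) (+-assoc (i ∸ δ) δ δ)) i+δ≤n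
    2δ≤2*δ+1 : δ + δ ≤ 2 * δ + 1
    2δ≤2*δ+1 = ≤-trans (≤-reflexive (cong (δ +_) (sym (+-identityʳ δ)))) (m≤m+n (2 * δ) 1)

lemma9 : {A : Set} (S : ℕ → A) (n τ : ℕ) → 1 ≤ τ → τ ≤ n →
    (ID : ℕ → ℕ) →
    (∀ j k → 1 ≤ j → j ≤ n ∸ τ + 1 → 1 ≤ k → k ≤ n ∸ τ + 1 →
      SubEq S j k τ → ID j ≡ ID k) →
    IsPartitioningSet S n (2 * τ) (2 * τ) (InP n τ ID)
lemma9 S n τ 1≤τ _ ID det =
  InP-bounded ,
  (λ i j 1+δ≤i i+δ≤n 1+δ≤j j+δ≤n sub →
    mk⇔ (InP-local det 2τ≤2*τ i j 1+δ≤i i+δ≤n 1+δ≤j j+δ≤n sub)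
        (InP-local det 2τ≤2*τ j i 1+δ≤j j+δ≤n 1+δ≤i i+δ≤n (SubEq-sym S sub))) ,
  λ p p' _ Ends-p' p<p' gap → inj₁ (≤-trans (InP-gap 1≤τ p p' Ends-p' p<p' gap) 2τ≤2*τ)
  where
  open WindowMinima S n τ ID
  2τ≤2*τ : τ + τ ≤ 2 * τ
  2τ≤2*τ = ≤-reflexive (cong (τ +_) (sym (+-identityʳ τ)))
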